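{- If $|J|=3p-2$ or $|J|=3p-1$, then $(p, J)=0$ implies $(2p, J)\equiv -1 \pmod p$.
   Context: Let $p$ be an odd prime and let $J$ be a finite set of lattice points in the Euclidean plane. For a positive integer $n$ and a finite set $X$ of lattice points, $(n, X)$ denotes the number of $n$-element subsets of $X$ the sum of whose elements (taken coordinatewise) is divisible by $p$, i.e. is $\equiv (0,0) \pmod p$. -}

module Defs where

open import Data.Nat using (ℕ; zero; suc; _+_)
open import Data.Integer as ℤ using (ℤ)
open import Data.Integer.Divisibility.Signed using (_∣?_)
open import Data.Product using (_×_; _,_)
open import Data.List using (List; []; _∷_; length; filter; map; _++_)
open import Relation.Nullary.Decidable using (_×-dec_)

Point : Set
Point = ℤ × ℤ

_⊕_ : Point → Point → Point
(a , b) ⊕ (c , d) = (a ℤ.+ c , b ℤ.+ d)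

origin : Point
origin = (ℤ.0ℤ , ℤ.0ℤ)

sumPts : List Point → Point
sumPts [] = origin
sumPts (x ∷ xs) = x ⊕ sumPts xs

-- All n-element sub-multisets chosen by position (sublists of length n).
-- When the list has no duplicates, these correspond exactly to the
-- n-element subsets of the underlying finite set.
choose : ℕ → List Point → List (List Point)
choose zero    _        = [] ∷ []
choose (suc n) []       = []
choose (suc n) (x ∷ xs) = map (x ∷_) (choose n xs) ++ choose (suc n) xs

-- (n , X): number of n-element subsets of X whose coordinatewise sum
-- is ≡ (0,0) mod p.
count : (p n : ℕ) → List Point → ℕ
count p n X =
  length (filter (λ S → let (a , b) = sumPts S in
                        (ℤ.+ p ∣? a) ×-dec (ℤ.+ p ∣? b))
                 (choose n X))

{-# OPTIONS --safe #-}
-- Proof idea (Chevalley–Warning).  Attach to every sublist S of J the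
-- vector w(S) = (|S|, ΣS) ∈ ℤ³ and put χ(a, b, c) = φ(a) φ(b) φ(c) with
-- φ(t) = 1 - t^(p-1).  By Fermat, χ(w(S)) ≡ 1 (mod p) exactly when p divides
-- |S| and ΣS ≡ (0,0), and 0 otherwise.  Since χ is a polynomial of degree
-- 3(p-1) < |J| and w is additive, the alternating sum Σ_S (-1)^|S| χ(w(S)) is
-- an iterated finite difference of χ of order |J|, hence vanishes.  Reading
-- it modulo p, only the sizes 0, p, 2p < 3p contribute:
-- 0 ≡ 1 - (p, J) + (2p, J) = 1 + (2p, J).
module Submission where

open import Defs

module _ where

  open import Data.Nat as ℕ
    using (ℕ; zero; suc; pred; _<_; _≤_; _∸_; _!; z<s; s<s; s≤s; NonZero)
  import Data.Nat.Properties as ℕ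
  import Data.Nat.Divisibility as ℕ
  open import Data.Nat.DivMod using (m/n*n≡m)
  open import Data.Nat.Combinatorics using (_C_; nCk≡n!/k![n-k]!; k![n∸k]!∣n!; nCn≡1)
  open import Data.Nat.Primality using (Prime; euclidsLemma; prime⇒nonZero; prime⇒nonTrivial)
  open import Data.Nat.Tactic.RingSolver as ℕ-Solver using ()
  open import Data.Integer as ℤ using (ℤ; +_; -[1+_]; _+_; _-_; _*_; -_; _^_; 0ℤ; 1ℤ; -1ℤ)
  import Data.Integer.Properties as ℤ
  open import Data.Integer.Divisibility.Signed
    using (_∣_; _∣?_; divides; ∣⇒∣ᵤ; ∣ᵤ⇒∣; ∣m∣n⇒∣m+n; ∣m∣n⇒∣m-n; ∣m⇒∣m*n; ∣m⇒∣-m)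
  open import Data.Integer.Tactic.RingSolver using (solve-∀)
  open import Data.Fin as Fin using (Fin; toℕ; inject₁; fromℕ)
  import Data.Fin.Properties as Fin
  open import Data.Product using (_×_; _,_; proj₁; proj₂)
  open import Data.Sum using (_⊎_; inj₁; inj₂; fromInj₂)
  open import Data.List using (List; []; _∷_; length; map; filter; _++_)
  open import Data.List.Properties using (filter-accept)
  open import Data.List.Relation.Unary.All as All using (All; []; _∷_)
  import Data.List.Relation.Unary.All.Properties as All
  open import Function using (_∘_)
  open import Relation.Nullary using (¬_; Dec; yes; no; contradiction)
  open import Relation.Nullary.Decidable using (_×-dec_)
  open import Relation.Binary.Bundles using (Setoid)
  open import Relation.Binary.PropositionalEquality

  import Algebra.Properties.CommutativeSemiring.Binomial ℤ.+-*-commutativeSemiring as Binomial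
  import Algebra.Properties.Semiring.Exp ℤ.+-*-semiring as Exp
  open import Algebra.Properties.Semiring.Mult ℤ.+-*-semiring using () renaming (_×_ to _·_)
  open import Algebra.Properties.Monoid.Sum ℤ.+-0-monoid using (sum; sum-init-last)

  ∑< : ℕ → (ℕ → ℤ) → ℤ
  ∑< zero    f = 0ℤ
  ∑< (suc n) f = f 0 + ∑< n (f ∘ suc)

  ∑<-cong : ∀ n {f g : ℕ → ℤ} → (∀ k → f k ≡ g k) → ∑< n f ≡ ∑< n g
  ∑<-cong zero    f≗g = refl
  ∑<-cong (suc n) f≗g = cong₂ _+_ (f≗g 0) (∑<-cong n (f≗g ∘ suc))

  ∑<-zero : ∀ n {f : ℕ → ℤ} → (∀ {k} → k < n → f k ≡ 0ℤ) → ∑< n f ≡ 0ℤ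
  ∑<-zero zero    f≡0 = refl
  ∑<-zero (suc n) f≡0 = cong₂ _+_ (f≡0 z<s) (∑<-zero n (f≡0 ∘ s<s))

  ∑<-minus : ∀ n (f g : ℕ → ℤ) → ∑< n f - ∑< n g ≡ ∑< n (λ k → f k - g k)
  ∑<-minus zero    f g = refl
  ∑<-minus (suc n) f g =
    trans (interchange (f 0) (g 0) _ _) (cong (_+_ (f 0 - g 0)) (∑<-minus n (f ∘ suc) (g ∘ suc)))
    where
    interchange : ∀ a b c d → (a + c) - (b + d) ≡ (a - b) + (c - d)
    interchange = solve-∀

  ∑<-split : ∀ m n (f : ℕ → ℤ) → ∑< (m ℕ.+ n) f ≡ ∑< m f + ∑< n (λ k → f (m ℕ.+ k))
  ∑<-split zero    n f = sym (ℤ.+-identityˡ _)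
  ∑<-split (suc m) n f = trans (cong (_+_ (f 0)) (∑<-split m n (f ∘ suc))) (sym (ℤ.+-assoc (f 0) _ _))

  ∑<-multiples : ∀ q {p} .{{_ : NonZero p}} (f : ℕ → ℤ) → (∀ {k} → ¬ p ℕ.∣ k → f k ≡ 0ℤ) →
                 ∑< (q ℕ.* p) f ≡ ∑< q (λ i → f (i ℕ.* p))
  ∑<-multiples zero    f f≡0 = refl
  ∑<-multiples (suc q) {p} f f≡0 = begin
    ∑< (p ℕ.+ q ℕ.* p) f
      ≡⟨ ∑<-split p (q ℕ.* p) f ⟩
    ∑< p f + ∑< (q ℕ.* p) (λ k → f (p ℕ.+ k))
      ≡⟨ cong₂ _+_ (block p f≡0) (∑<-multiples q _ f[p+k]≡0) ⟩
    f 0 + ∑< q (λ i → f (p ℕ.+ i ℕ.* p)) ∎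
    where
    open ≡-Reasoning
    block : ∀ n .{{_ : NonZero n}} → (∀ {k} → ¬ n ℕ.∣ k → f k ≡ 0ℤ) → ∑< n f ≡ f 0
    block (suc m) f≡0 =
      trans (cong (_+_ (f 0)) (∑<-zero m (λ k<m → f≡0 (λ n∣1+k → ℕ.<⇒≱ (s<s k<m) (ℕ.∣⇒≤ n∣1+k)))))
            (ℤ.+-identityʳ (f 0))
    f[p+k]≡0 : ∀ {k} → ¬ p ℕ.∣ k → f (p ℕ.+ k) ≡ 0ℤ
    f[p+k]≡0 p∤k = f≡0 (λ p∣p+k → p∤k (ℕ.∣m+n∣m⇒∣n p∣p+k ℕ.∣-refl))

  sumMap : {A : Set} → (A → ℤ) → List A → ℤ
  sumMap f []       = 0ℤ
  sumMap f (x ∷ xs) = f x + sumMap f xs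

  sumMap-++ : ∀ {A : Set} (f : A → ℤ) xs ys → sumMap f (xs ++ ys) ≡ sumMap f xs + sumMap f ys
  sumMap-++ f []       ys = sym (ℤ.+-identityˡ _)
  sumMap-++ f (x ∷ xs) ys = trans (cong (_+_ (f x)) (sumMap-++ f xs ys)) (sym (ℤ.+-assoc (f x) _ _))

  sumMap-map : ∀ {A B : Set} (f : B → ℤ) (g : A → B) xs → sumMap f (map g xs) ≡ sumMap (f ∘ g) xs
  sumMap-map f g []       = refl
  sumMap-map f g (x ∷ xs) = cong (_+_ (f (g x))) (sumMap-map f g xs)

  sumMap-*ˡ : ∀ {A : Set} c (f : A → ℤ) xs → sumMap (λ x → c * f x) xs ≡ c * sumMap f xs
  sumMap-*ˡ c f []       = sym (ℤ.*-zeroʳ c)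
  sumMap-*ˡ c f (x ∷ xs) = trans (cong (_+_ (c * f x)) (sumMap-*ˡ c f xs)) (sym (ℤ.*-distribˡ-+ c (f x) _))

  indicator : {P : Set} → Dec P → ℤ
  indicator (yes _) = 1ℤ
  indicator (no _)  = 0ℤ

  indicator-yes : ∀ {P : Set} (P? : Dec P) → P → indicator P? ≡ 1ℤ
  indicator-yes (yes _) _  = refl
  indicator-yes (no ¬p) p = contradiction p ¬p

  indicator-no : ∀ {P : Set} (P? : Dec P) → ¬ P → indicator P? ≡ 0ℤ
  indicator-no (yes p) ¬p = contradiction p ¬p
  indicator-no (no _)  _  = refl

  indicator-× : ∀ {P Q : Set} (P? : Dec P) (Q? : Dec Q) → indicator (P? ×-dec Q?) ≡ indicator P? * indicator Q?
  indicator-× (yes _) (yes _) = refl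
  indicator-× (yes _) (no _)  = refl
  indicator-× (no _)  (yes _) = refl
  indicator-× (no _)  (no _)  = refl

  sumMap-indicator : ∀ {A : Set} {P : A → Set} (P? : ∀ x → Dec (P x)) xs →
                     sumMap (indicator ∘ P?) xs ≡ + length (filter P? xs)
  sumMap-indicator P? []       = refl
  sumMap-indicator P? (x ∷ xs) with P? x
  ... | yes _ = cong (_+_ 1ℤ) (sumMap-indicator P? xs)
  ... | no  _ = trans (ℤ.+-identityˡ _) (sumMap-indicator P? xs)

  -- alternatingSum xs g is the sum of (-1)^|S| g S over all sublists S of xs.
  alternatingSum : {A : Set} → List A → (List A → ℤ) → ℤ
  alternatingSum []       g = g []
  alternatingSum (x ∷ xs) g = alternatingSum xs g - alternatingSum xs (g ∘ (x ∷_))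

  alternatingSum-cong : ∀ {A : Set} (xs : List A) {f g : List A → ℤ} → (∀ S → f S ≡ g S) →
                        alternatingSum xs f ≡ alternatingSum xs g
  alternatingSum-cong []       f≗g = f≗g []
  alternatingSum-cong (x ∷ xs) f≗g =
    cong₂ _-_ (alternatingSum-cong xs f≗g) (alternatingSum-cong xs (f≗g ∘ (x ∷_)))

  alternatingSum-zero : ∀ {A : Set} (xs : List A) {f : List A → ℤ} → (∀ S → f S ≡ 0ℤ) →
                        alternatingSum xs f ≡ 0ℤ
  alternatingSum-zero []       f≡0 = f≡0 []
  alternatingSum-zero (x ∷ xs) f≡0 =
    cong₂ _-_ (alternatingSum-zero xs f≡0) (alternatingSum-zero xs (f≡0 ∘ (x ∷_)))

  alternatingSum-minus : ∀ {A : Set} (xs : List A) (f g : List A → ℤ) →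
                             alternatingSum xs f - alternatingSum xs g ≡ alternatingSum xs (λ S → f S - g S)
  alternatingSum-minus []       f g = refl
  alternatingSum-minus (x ∷ xs) f g = begin
    (Σf - Σfₓ) - (Σg - Σgₓ)   ≡⟨ interchange Σf Σfₓ Σg Σgₓ ⟩
    (Σf - Σg) - (Σfₓ - Σgₓ)   ≡⟨ cong₂ _-_ (alternatingSum-minus xs f g)
                                           (alternatingSum-minus xs (f ∘ (x ∷_)) (g ∘ (x ∷_))) ⟩
    alternatingSum (x ∷ xs) (λ S → f S - g S) ∎
    where
    open ≡-Reasoning
    Σf Σg Σfₓ Σgₓ : ℤ
    Σf = alternatingSum xs f
    Σg = alternatingSum xs g
    Σfₓ = alternatingSum xs (f ∘ (x ∷_))
    Σgₓ = alternatingSum xs (g ∘ (x ∷_))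
    interchange : ∀ a b c d → (a - b) - (c - d) ≡ (a - c) - (b - d)
    interchange = solve-∀

  sumMap-choose-∷ : ∀ (g : List Point → ℤ) k x xs →
                    sumMap g (choose (suc k) (x ∷ xs)) ≡
                    sumMap (g ∘ (x ∷_)) (choose k xs) + sumMap g (choose (suc k) xs)
  sumMap-choose-∷ g k x xs = trans (sumMap-++ g (map (x ∷_) (choose k xs)) (choose (suc k) xs))
                                   (cong (_+ sumMap g (choose (suc k) xs)) (sumMap-map g (x ∷_) (choose k xs)))

  choose-length : ∀ k xs → All (λ S → length S ≡ k) (choose k xs)
  choose-length zero    xs       = refl ∷ []
  choose-length (suc k) []       = []
  choose-length (suc k) (x ∷ xs) =
    All.++⁺ (All.map⁺ (All.map (cong suc) (choose-length k xs))) (choose-length (suc k) xs)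

  alternatingSum-choose : ∀ xs (g : List Point → ℤ) M → length xs < M →
                          alternatingSum xs g ≡ ∑< M (λ k → -1ℤ ^ k * sumMap g (choose k xs))
  alternatingSum-choose [] g (suc M) _ =
    sym (trans (cong (_+_ (1ℤ * (g [] + 0ℤ))) (∑<-zero M (λ {k} _ → ℤ.*-zeroʳ (-1ℤ ^ suc k)))) (unit (g [])))
    where
    unit : ∀ a → 1ℤ * (a + 0ℤ) + 0ℤ ≡ a
    unit = solve-∀
  alternatingSum-choose (x ∷ xs) g (suc M) (s<s |xs|<M) = begin
    alternatingSum xs g - alternatingSum xs gₓ
      ≡⟨ cong₂ _-_ (alternatingSum-choose xs g (suc M) (ℕ.m<n⇒m<1+n |xs|<M))
                   (alternatingSum-choose xs gₓ M |xs|<M) ⟩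
    (c₀ + ∑< M (λ k → -1ℤ ^ suc k * B (suc k))) - ∑< M (λ k → -1ℤ ^ k * A k)
      ≡⟨ reassoc c₀ _ _ ⟩
    c₀ + (∑< M (λ k → -1ℤ ^ suc k * B (suc k)) - ∑< M (λ k → -1ℤ ^ k * A k))
      ≡⟨ cong (_+_ c₀) (∑<-minus M _ _) ⟩
    c₀ + ∑< M (λ k → -1ℤ ^ suc k * B (suc k) - -1ℤ ^ k * A k)
      ≡⟨ cong (_+_ c₀) (∑<-cong M (λ k → trans (pascal (-1ℤ ^ k) (A k) (B (suc k)))
                                                (cong (-1ℤ ^ suc k *_) (sym (sumMap-choose-∷ g k x xs))))) ⟩
    c₀ + ∑< M (λ k → -1ℤ ^ suc k * sumMap g (choose (suc k) (x ∷ xs))) ∎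
    where
    open ≡-Reasoning
    gₓ : List Point → ℤ
    gₓ = g ∘ (x ∷_)
    A B : ℕ → ℤ
    A k = sumMap gₓ (choose k xs)
    B k = sumMap g (choose k xs)
    c₀ : ℤ
    c₀ = 1ℤ * (g [] + 0ℤ)
    reassoc : ∀ a b c → (a + b) - c ≡ a + (b - c)
    reassoc = solve-∀
    pascal : ∀ s a b → (-1ℤ * s) * b - s * a ≡ (-1ℤ * s) * (a + b)
    pascal = solve-∀

  -- DegreeBelow k f is the finite-difference form of "f is a polynomial of degree < k".
  module Differences {G : Set} (_∙_ : G → G → G) (∙-swap : ∀ x y v → x ∙ (y ∙ v) ≡ y ∙ (x ∙ v)) where

    Δ : G → (G → ℤ) → G → ℤ
    Δ x f v = f v - f (x ∙ v)

    data DegreeBelow : ℕ → (G → ℤ) → Set where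
      vanishes    : ∀ {f} → (∀ v → f v ≡ 0ℤ) → DegreeBelow zero f
      differences : ∀ {k f} → (∀ x → DegreeBelow k (Δ x f)) → DegreeBelow (suc k) f

    DegreeBelow-cong : ∀ {k} {f g : G → ℤ} → (∀ v → f v ≡ g v) → DegreeBelow k f → DegreeBelow k g
    DegreeBelow-cong f≗g (vanishes f≡0)   = vanishes (λ v → trans (sym (f≗g v)) (f≡0 v))
    DegreeBelow-cong f≗g (differences df) =
      differences (λ x → DegreeBelow-cong (λ v → cong₂ _-_ (f≗g v) (f≗g (x ∙ v))) (df x))

    DegreeBelow-zero : ∀ k {f : G → ℤ} → (∀ v → f v ≡ 0ℤ) → DegreeBelow k f
    DegreeBelow-zero zero    f≡0 = vanishes f≡0
    DegreeBelow-zero (suc k) f≡0 =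
      differences (λ x → DegreeBelow-zero k (λ v → cong₂ _-_ (f≡0 v) (f≡0 (x ∙ v))))

    DegreeBelow-const : ∀ k c → DegreeBelow (suc k) (λ _ → c)
    DegreeBelow-const k c = differences (λ _ → DegreeBelow-zero k (λ _ → ℤ.+-inverseʳ c))

    DegreeBelow-+ : ∀ {k} {f g : G → ℤ} → DegreeBelow k f → DegreeBelow k g →
                    DegreeBelow k (λ v → f v + g v)
    DegreeBelow-+ (vanishes f≡0) (vanishes g≡0) = vanishes (λ v → cong₂ _+_ (f≡0 v) (g≡0 v))
    DegreeBelow-+ {f = f} {g} (differences df) (differences dg) =
      differences (λ x → DegreeBelow-cong (λ v → interchange (f v) (g v) _ _) (DegreeBelow-+ (df x) (dg x)))
      where
      interchange : ∀ a b c d → (a - c) + (b - d) ≡ (a + b) - (c + d)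
      interchange = solve-∀

    DegreeBelow-minus : ∀ {k} {f g : G → ℤ} → DegreeBelow k f → DegreeBelow k g →
                        DegreeBelow k (λ v → f v - g v)
    DegreeBelow-minus (vanishes f≡0) (vanishes g≡0) = vanishes (λ v → cong₂ _-_ (f≡0 v) (g≡0 v))
    DegreeBelow-minus {f = f} {g} (differences df) (differences dg) =
      differences (λ x → DegreeBelow-cong (λ v → interchange (f v) (g v) _ _) (DegreeBelow-minus (df x) (dg x)))
      where
      interchange : ∀ a b c d → (a - c) - (b - d) ≡ (a - b) - (c - d)
      interchange = solve-∀

    DegreeBelow-shift : ∀ {k} {f : G → ℤ} y → DegreeBelow k f → DegreeBelow k (λ v → f (y ∙ v))
    DegreeBelow-shift y (vanishes f≡0) = vanishes (λ v → f≡0 (y ∙ v))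
    DegreeBelow-shift {f = f} y (differences df) =
      differences (λ x → DegreeBelow-cong (λ v → cong (λ u → f (y ∙ v) - f u) (∙-swap x y v))
                                          (DegreeBelow-shift y (df x)))

    DegreeBelow-* : ∀ a b {f g : G → ℤ} → DegreeBelow (suc a) f → DegreeBelow (suc b) g →
                    DegreeBelow (suc (a ℕ.+ b)) (λ v → f v * g v)
    DegreeBelow-* a b {f} {g} df@(differences Δf) dg@(differences Δg) = differences λ x →
      DegreeBelow-cong (λ v → sym (leibniz (f v) (g v) (f (x ∙ v)) (g (x ∙ v))))
                       (DegreeBelow-+ (h·g a (Δf x)) (f[y∙]·h b x (Δg x)))
      where
      leibniz : ∀ a b c d → a * b - c * d ≡ (a - c) * b + c * (b - d)
      leibniz = solve-∀
      h·g : ∀ a {h} → DegreeBelow a h → DegreeBelow (a ℕ.+ b) (λ v → h v * g v)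
      h·g zero    (vanishes h≡0) = DegreeBelow-zero b (λ v → cong (_* g v) (h≡0 v))
      h·g (suc a) dh             = DegreeBelow-* a b dh dg
      f[y∙]·h : ∀ b y {h} → DegreeBelow b h → DegreeBelow (a ℕ.+ b) (λ v → f (y ∙ v) * h v)
      f[y∙]·h zero    y (vanishes h≡0) =
        DegreeBelow-zero (a ℕ.+ 0) (λ v → trans (cong (f (y ∙ v) *_) (h≡0 v)) (ℤ.*-zeroʳ (f (y ∙ v))))
      f[y∙]·h (suc b) y {h} dh = subst (λ n → DegreeBelow n (λ v → f (y ∙ v) * h v)) (sym (ℕ.+-suc a b))
                                   (DegreeBelow-* a b (DegreeBelow-shift y df) dh)

    DegreeBelow-additive : ∀ {π : G → ℤ} → (∀ x v → π (x ∙ v) ≡ π x + π v) → DegreeBelow 2 π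
    DegreeBelow-additive {π} additive = differences λ x →
      DegreeBelow-cong (λ v → sym (trans (cong (_-_ (π v)) (additive x v)) (cancel (π v) (π x))))
                       (DegreeBelow-const 0 (- π x))
      where
      cancel : ∀ a b → a - (b + a) ≡ - b
      cancel = solve-∀

    DegreeBelow-^ : ∀ {π : G → ℤ} → DegreeBelow 2 π → ∀ k → DegreeBelow (suc k) (λ v → π v ^ k)
    DegreeBelow-^ dπ zero    = DegreeBelow-const 0 1ℤ
    DegreeBelow-^ dπ (suc k) = DegreeBelow-* 1 k dπ (DegreeBelow-^ dπ k)

    alternatingSum-vanishes : ∀ {A : Set} (w : List A → G) (e : A → G) → (∀ x S → w (x ∷ S) ≡ e x ∙ w S) →
                              ∀ {k h} xs → DegreeBelow k h → k ≤ length xs → alternatingSum xs (h ∘ w) ≡ 0ℤ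
    alternatingSum-vanishes w e w-∷ xs (vanishes h≡0) _ = alternatingSum-zero xs (h≡0 ∘ w)
    alternatingSum-vanishes w e w-∷ {h = h} (x ∷ xs) (differences dh) (s≤s k≤|xs|) = begin
      alternatingSum xs (h ∘ w) - alternatingSum xs (h ∘ w ∘ (x ∷_))
        ≡⟨ alternatingSum-minus xs (h ∘ w) (h ∘ w ∘ (x ∷_)) ⟩
      alternatingSum xs (λ S → h (w S) - h (w (x ∷ S)))
        ≡⟨ alternatingSum-cong xs (λ S → cong (λ u → h (w S) - h u) (w-∷ x S)) ⟩
      alternatingSum xs (Δ (e x) h ∘ w)
        ≡⟨ alternatingSum-vanishes w e w-∷ xs (dh (e x)) k≤|xs| ⟩
      0ℤ ∎
      where open ≡-Reasoning

  module Congruence (n : ℤ) where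

    infix 4 _≈_
    record _≈_ (x y : ℤ) : Set where
      constructor mod
      field n∣x-y : n ∣ x - y

    ≈-refl : ∀ {x} → x ≈ x
    ≈-refl {x} = mod (subst (n ∣_) (sym (ℤ.+-inverseʳ x)) (divides 0ℤ refl))

    ≈-reflexive : ∀ {x y} → x ≡ y → x ≈ y
    ≈-reflexive refl = ≈-refl

    ≈-sym : ∀ {x y} → x ≈ y → y ≈ x
    ≈-sym {x} {y} (mod d) = mod (subst (n ∣_) (negate x y) (∣m⇒∣-m d))
      where
      negate : ∀ x y → - (x - y) ≡ y - x
      negate = solve-∀

    ≈-trans : ∀ {x y z} → x ≈ y → y ≈ z → x ≈ z
    ≈-trans {x} {y} {z} (mod d) (mod e) = mod (subst (n ∣_) (ℤ.+-minus-telescope x y z) (∣m∣n⇒∣m+n d e))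

    +-cong : ∀ {a b c d} → a ≈ b → c ≈ d → a + c ≈ b + d
    +-cong {a} {b} {c} {d} (mod x) (mod y) = mod (subst (n ∣_) (interchange a b c d) (∣m∣n⇒∣m+n x y))
      where
      interchange : ∀ a b c d → (a - b) + (c - d) ≡ (a + c) - (b + d)
      interchange = solve-∀

    *-cong : ∀ {a b c d} → a ≈ b → c ≈ d → a * c ≈ b * d
    *-cong {a} {b} {c} {d} (mod x) (mod y) =
      mod (subst (n ∣_) (leibniz a b c d) (∣m∣n⇒∣m+n (∣m⇒∣m*n c x) (∣m⇒∣m*n b y)))
      where
      leibniz : ∀ a b c d → (a - b) * c + (c - d) * b ≡ a * c - b * d
      leibniz = solve-∀

    ≈-setoid : Setoid _ _
    ≈-setoid = record { _≈_ = _≈_ ; isEquivalence = record { refl = ≈-refl ; sym = ≈-sym ; trans = ≈-trans } }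

    ≈0⇒∣ : ∀ {x} → x ≈ 0ℤ → n ∣ x
    ≈0⇒∣ {x} (mod d) = subst (n ∣_) (ℤ.+-identityʳ x) d

    ∑<-congᴹ : ∀ k {f g : ℕ → ℤ} → (∀ i → f i ≈ g i) → ∑< k f ≈ ∑< k g
    ∑<-congᴹ zero    f≈g = ≈-refl
    ∑<-congᴹ (suc k) f≈g = +-cong (f≈g 0) (∑<-congᴹ k (f≈g ∘ suc))

    sumMap-congᴹ : ∀ {A : Set} {f g : A → ℤ} {xs} → All (λ x → f x ≈ g x) xs → sumMap f xs ≈ sumMap g xs
    sumMap-congᴹ []           = ≈-refl
    sumMap-congᴹ (fx≈gx ∷ eq) = +-cong fx≈gx (sumMap-congᴹ eq)

  ∣-sum : ∀ {d : ℤ} {n} (t : Fin n → ℤ) → (∀ i → d ∣ t i) → d ∣ sum t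
  ∣-sum {n = zero}  t d∣t = divides 0ℤ refl
  ∣-sum {n = suc n} t d∣t = ∣m∣n⇒∣m+n (d∣t Fin.zero) (∣-sum (t ∘ Fin.suc) (d∣t ∘ Fin.suc))

  ·≡* : ∀ n x → n · x ≡ + n * x
  ·≡* zero    x = refl
  ·≡* (suc n) x = trans (cong (_+_ x) (·≡* n x)) (sym (ℤ.suc-* (+ n) x))

  ^≡^ : ∀ x n → x Exp.^ n ≡ x ^ n
  ^≡^ x zero    = refl
  ^≡^ x (suc n) = cong (x *_) (^≡^ x n)

  freshman's-dream : ∀ {d : ℤ} n .{{_ : NonZero n}} x → (∀ {k} → 0 < k → k < n → d ∣ + (n C k)) →
                     d ∣ (1ℤ + x) ^ n - (1ℤ + x ^ n)
  freshman's-dream {d} (suc m) x d∣C = subst (d ∣_) middle≡ (∣-sum middle d∣middle)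
    where
    open Binomial using (binomialTerm; binomialExpansion; theorem)
    open ≡-Reasoning
    t : Fin (suc (suc m)) → ℤ
    t = binomialTerm 1ℤ x (suc m)
    middle : Fin m → ℤ
    middle i = t (Fin.suc (inject₁ i))

    first : t Fin.zero ≡ x ^ suc m
    first = trans (ℤ.+-identityʳ _) (trans (ℤ.*-identityˡ _) (^≡^ x (suc m)))

    last : t (Fin.suc (fromℕ m)) ≡ 1ℤ
    last = begin
      t (Fin.suc (fromℕ m))
        ≡⟨ cong (λ j → (suc m C suc j) · (1ℤ Exp.^ suc j * x Exp.^ (m ∸ j))) (Fin.toℕ-fromℕ m) ⟩
      (suc m C suc m) · (1ℤ Exp.^ suc m * x Exp.^ (m ∸ m))
        ≡⟨ cong₂ (λ c e → c · (1ℤ Exp.^ suc m * x Exp.^ e)) (nCn≡1 (suc m)) (ℕ.n∸n≡0 m) ⟩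
      1ℤ Exp.^ suc m * 1ℤ + 0ℤ
        ≡⟨ trans (ℤ.+-identityʳ _) (trans (ℤ.*-identityʳ _) (^≡^ 1ℤ (suc m))) ⟩
      1ℤ ^ suc m
        ≡⟨ ℤ.^-zeroˡ (suc m) ⟩
      1ℤ ∎

    expansion : binomialExpansion 1ℤ x (suc m) ≡ x ^ suc m + (sum middle + 1ℤ)
    expansion = cong₂ _+_ first (trans (sum-init-last (t ∘ Fin.suc)) (cong (_+_ (sum middle)) last))

    middle≡ : sum middle ≡ (1ℤ + x) ^ suc m - (1ℤ + x ^ suc m)
    middle≡ = begin
      sum middle                                            ≡⟨ rearrange (sum middle) (x ^ suc m) ⟩
      x ^ suc m + (sum middle + 1ℤ) - (1ℤ + x ^ suc m)      ≡⟨ cong (_- (1ℤ + x ^ suc m)) (sym expansion) ⟩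
      binomialExpansion 1ℤ x (suc m) - (1ℤ + x ^ suc m)    ≡⟨ cong (_- (1ℤ + x ^ suc m)) (theorem (suc m) 1ℤ x) ⟨
      (1ℤ + x) Exp.^ suc m - (1ℤ + x ^ suc m)               ≡⟨ cong (_- (1ℤ + x ^ suc m)) (^≡^ (1ℤ + x) (suc m)) ⟩
      (1ℤ + x) ^ suc m - (1ℤ + x ^ suc m)                   ∎
      where
      rearrange : ∀ M y → M ≡ y + (M + 1ℤ) - (1ℤ + y)
      rearrange = solve-∀

    d∣middle : ∀ i → d ∣ middle i
    d∣middle i = subst (d ∣_) (sym (·≡* (suc m C suc j) _)) (∣m⇒∣m*n _ (d∣C z<s (s<s j<m)))
      where
      j : ℕ
      j = toℕ (inject₁ i)
      j<m : j < m
      j<m = subst (_< m) (sym (Fin.toℕ-inject₁ i)) (Fin.toℕ<n i)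

  n∣n! : ∀ n .{{_ : NonZero n}} → n ℕ.∣ n !
  n∣n! (suc n) = ℕ.m∣m*n (n !)

  nCk*k!*[n∸k]!≡n! : ∀ {n k} → k ≤ n → (n C k) ℕ.* (k ! ℕ.* (n ∸ k) !) ≡ n !
  nCk*k!*[n∸k]!≡n! {n} {k} k≤n = trans (cong (ℕ._* (k ! ℕ.* (n ∸ k) !)) (nCk≡n!/k![n-k]! k≤n))
                                       (m/n*n≡m {{k ℕ.!* (n ∸ k) !≢0}} (k![n∸k]!∣n! k≤n))

  ℤ-induction : ∀ {Q : ℤ → Set} → Q 0ℤ → (∀ x → Q x → Q (1ℤ + x)) → (∀ x → Q (1ℤ + x) → Q x) →
                ∀ x → Q x
  ℤ-induction q₀ up down (+ zero)      = q₀
  ℤ-induction q₀ up down (+ suc n)     = up (+ n) (ℤ-induction q₀ up down (+ n))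
  ℤ-induction q₀ up down -[1+ zero ]   = down -[1+ 0 ] q₀
  ℤ-induction q₀ up down -[1+ suc n ]  = down -[1+ suc n ] (ℤ-induction q₀ up down -[1+ n ])

  ∣⇒∣^ : ∀ {d x : ℤ} n .{{_ : NonZero n}} → d ∣ x → d ∣ x ^ n
  ∣⇒∣^ {x = x} (suc n) d∣x = ∣m⇒∣m*n (x ^ n) d∣x

  _⊞_ : ℤ × Point → ℤ × Point → ℤ × Point
  (a , u) ⊞ (b , v) = (a + b , u ⊕ v)

  ⊞-swap : ∀ u v w → u ⊞ (v ⊞ w) ≡ v ⊞ (u ⊞ w)
  ⊞-swap (a , b , c) (a′ , b′ , c′) (a″ , b″ , c″) =
    cong₂ _,_ (swap a a′ a″) (cong₂ _,_ (swap b b′ b″) (swap c c′ c″))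
    where
    swap : ∀ x y z → x + (y + z) ≡ y + (x + z)
    swap = solve-∀

  weight : List Point → ℤ × Point
  weight S = (+ length S , sumPts S)

  open Differences _⊞_ ⊞-swap

  3*[1+m]≡3+[m+[m+m]] : ∀ m → 3 ℕ.* suc m ≡ 3 ℕ.+ (m ℕ.+ (m ℕ.+ m))
  3*[1+m]≡3+[m+[m+m]] = ℕ-Solver.solve-∀

  sizeBounds : ∀ {n} p .{{_ : NonZero p}} → n ≡ 3 ℕ.* p ∸ 2 ⊎ n ≡ 3 ℕ.* p ∸ 1 →
               suc (pred p ℕ.+ (pred p ℕ.+ pred p)) ≤ n × n < 3 ℕ.* p
  sizeBounds (suc m) = bounds (3*[1+m]≡3+[m+[m+m]] m)
    where
    bounds : ∀ {n N X} → N ≡ 3 ℕ.+ X → n ≡ N ∸ 2 ⊎ n ≡ N ∸ 1 → suc X ≤ n × n < N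
    bounds refl (inj₁ refl) = ℕ.≤-refl , ℕ.m<n⇒m<1+n ℕ.≤-refl
    bounds refl (inj₂ refl) = ℕ.n≤1+n _ , ℕ.≤-refl

  module ModPrime {p : ℕ} (isPrime : Prime p) where

    instance
      p≢0 : NonZero p
      p≢0 = prime⇒nonZero isPrime

      p-1≢0 : NonZero (pred p)
      p-1≢0 = ℕ.>-nonZero (ℕ.pred-mono-< {1} (ℕ.nonTrivial⇒n>1 p {{prime⇒nonTrivial isPrime}}))

    open Congruence (+ p)

    prime∤! : ∀ {n} → n < p → ¬ p ℕ.∣ n !
    prime∤! {zero}  _   p∣1 = ℕ.nonTrivial⇒≢1 {{prime⇒nonTrivial isPrime}} (ℕ.∣1⇒≡1 p∣1)
    prime∤! {suc n} n<p p∣n! with euclidsLemma (suc n) (n !) isPrime p∣n!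
    ... | inj₁ p∣1+n = ℕ.<⇒≱ n<p (ℕ.∣⇒≤ p∣1+n)
    ... | inj₂ p∣n!  = prime∤! (ℕ.<-trans (ℕ.n<1+n n) n<p) p∣n!

    prime∣C : ∀ {k} → 0 < k → k < p → p ℕ.∣ (p C k)
    prime∣C {k} 0<k k<p
      with euclidsLemma (p C k) (k ! ℕ.* (p ∸ k) !) isPrime
             (subst (p ℕ.∣_) (sym (nCk*k!*[n∸k]!≡n! (ℕ.<⇒≤ k<p))) (n∣n! p))
    ... | inj₁ p∣C          = p∣C
    ... | inj₂ p∣k![p-k]! with euclidsLemma (k !) ((p ∸ k) !) isPrime p∣k![p-k]!
    ...   | inj₁ p∣k!     = contradiction p∣k! (prime∤! k<p)
    ...   | inj₂ p∣[p-k]! = contradiction p∣[p-k]! (prime∤! (ℕ.∸-monoʳ-< 0<k (ℕ.<⇒≤ k<p)))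

    euclidsLemmaℤ : ∀ x y → + p ∣ x * y → + p ∣ x ⊎ + p ∣ y
    euclidsLemmaℤ x y p∣xy
      with euclidsLemma ℤ.∣ x ∣ ℤ.∣ y ∣ isPrime (subst (p ℕ.∣_) (ℤ.abs-* x y) (∣⇒∣ᵤ p∣xy))
    ... | inj₁ p∣x = inj₁ (∣ᵤ⇒∣ p∣x)
    ... | inj₂ p∣y = inj₂ (∣ᵤ⇒∣ p∣y)

    fermat : ∀ x → + p ∣ x ^ p - x
    fermat = ℤ-induction (subst (+ p ∣_) (sym (ℤ.+-identityʳ _)) (∣⇒∣^ p (divides 0ℤ refl))) up down
      where
      step : ∀ x → + p ∣ (1ℤ + x) ^ p - (1ℤ + x ^ p)
      step x = freshman's-dream p x (λ 0<k k<p → ∣ᵤ⇒∣ (prime∣C 0<k k<p))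
      up : ∀ x → + p ∣ x ^ p - x → + p ∣ (1ℤ + x) ^ p - (1ℤ + x)
      up x p∣x^p-x = subst (+ p ∣_) (add (x ^ p) x ((1ℤ + x) ^ p)) (∣m∣n⇒∣m+n (step x) p∣x^p-x)
        where
        add : ∀ y x z → (z - (1ℤ + y)) + (y - x) ≡ z - (1ℤ + x)
        add = solve-∀
      down : ∀ x → + p ∣ (1ℤ + x) ^ p - (1ℤ + x) → + p ∣ x ^ p - x
      down x p∣step = subst (+ p ∣_) (subtract (x ^ p) x ((1ℤ + x) ^ p)) (∣m∣n⇒∣m-n p∣step (step x))
        where
        subtract : ∀ y x z → (z - (1ℤ + x)) - (z - (1ℤ + y)) ≡ y - x
        subtract = solve-∀

    fermat′ : ∀ x → ¬ + p ∣ x → + p ∣ x ^ pred p - 1ℤ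
    fermat′ x p∤x =
      fromInj₂ (λ p∣x → contradiction p∣x p∤x) (euclidsLemmaℤ x (x ^ pred p - 1ℤ) p∣x[x^[p-1]-1])
      where
      factor : ∀ x y → x * y - x ≡ x * (y - 1ℤ)
      factor = solve-∀
      p∣x[x^[p-1]-1] : + p ∣ x * (x ^ pred p - 1ℤ)
      p∣x[x^[p-1]-1] = subst (+ p ∣_) (factor x (x ^ pred p))
                             (subst (λ q → + p ∣ x ^ q - x) (sym (ℕ.suc-pred p)) (fermat x))

    φ : ℤ → ℤ
    φ x = 1ℤ - x ^ pred p

    φ≈indicator : ∀ x → φ x ≈ indicator (+ p ∣? x)
    φ≈indicator x with + p ∣? x
    ... | yes p∣x = mod (subst (+ p ∣_) (shift (x ^ pred p)) (∣m⇒∣-m (∣⇒∣^ (pred p) p∣x)))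
      where
      shift : ∀ y → - y ≡ (1ℤ - y) - 1ℤ
      shift = solve-∀
    ... | no  p∤x = mod (subst (+ p ∣_) (shift (x ^ pred p)) (∣m⇒∣-m (fermat′ x p∤x)))
      where
      shift : ∀ y → - (y - 1ℤ) ≡ (1ℤ - y) - 0ℤ
      shift = solve-∀

    χ : ℤ × Point → ℤ
    χ (a , b , c) = φ a * (φ b * φ c)

    DegreeBelow-χ : DegreeBelow (suc (pred p ℕ.+ (pred p ℕ.+ pred p))) χ
    DegreeBelow-χ =
      DegreeBelow-* (pred p) _ (DegreeBelow-φ∘ (λ _ _ → refl))
        (DegreeBelow-* (pred p) (pred p) (DegreeBelow-φ∘ (λ _ _ → refl)) (DegreeBelow-φ∘ (λ _ _ → refl)))
      where
      DegreeBelow-φ∘ : ∀ {π} → (∀ x v → π (x ⊞ v) ≡ π x + π v) → DegreeBelow (suc (pred p)) (φ ∘ π)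
      DegreeBelow-φ∘ additive = DegreeBelow-minus (DegreeBelow-const (pred p) 1ℤ)
                                              (DegreeBelow-^ (DegreeBelow-additive additive) (pred p))

    -- count p k xs unfolds to length (filter zeroSum? (choose k xs)).
    zeroSum? : ∀ S → Dec (+ p ∣ proj₁ (sumPts S) × + p ∣ proj₂ (sumPts S))
    zeroSum? S = (+ p ∣? proj₁ (sumPts S)) ×-dec (+ p ∣? proj₂ (sumPts S))

    χ∘weight≈ : ∀ {k} S → length S ≡ k → χ (weight S) ≈ indicator (+ p ∣? + k) * indicator (zeroSum? S)
    χ∘weight≈ S refl = *-cong (φ≈indicator (+ length S))
      (≈-trans (*-cong (φ≈indicator (proj₁ (sumPts S))) (φ≈indicator (proj₂ (sumPts S))))
               (≈-reflexive (sym (indicator-× (+ p ∣? proj₁ (sumPts S)) (+ p ∣? proj₂ (sumPts S))))))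

    sumMap-χ∘weight : ∀ k xs → sumMap (χ ∘ weight) (choose k xs) ≈ indicator (+ p ∣? + k) * + count p k xs
    sumMap-χ∘weight k xs = begin
      sumMap (χ ∘ weight) (choose k xs)
        ≈⟨ sumMap-congᴹ (All.map (λ {S} → χ∘weight≈ S) (choose-length k xs)) ⟩
      sumMap (λ S → indicator (+ p ∣? + k) * indicator (zeroSum? S)) (choose k xs)
        ≡⟨ sumMap-*ˡ (indicator (+ p ∣? + k)) (indicator ∘ zeroSum?) (choose k xs) ⟩
      indicator (+ p ∣? + k) * sumMap (indicator ∘ zeroSum?) (choose k xs)
        ≡⟨ cong (_*_ (indicator (+ p ∣? + k))) (sumMap-indicator zeroSum? (choose k xs)) ⟩
      indicator (+ p ∣? + k) * + count p k xs ∎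
      where open import Relation.Binary.Reasoning.Setoid ≈-setoid

    count0≡1 : ∀ xs → count p 0 xs ≡ 1
    count0≡1 xs = cong length (filter-accept zeroSum? (divides 0ℤ refl , divides 0ℤ refl))

    signedCount : List Point → ℕ → ℤ
    signedCount xs k = -1ℤ ^ k * (indicator (+ p ∣? + k) * + count p k xs)

    ∑<-signedCount : ∀ xs → count p p xs ≡ 0 →
                     ∑< (3 ℕ.* p) (signedCount xs) ≡ + count p (2 ℕ.* p) xs + 1ℤ
    ∑<-signedCount xs none = begin
      ∑< (3 ℕ.* p) U                                  ≡⟨ ∑<-multiples 3 {p} U U-off ⟩
      U 0 + (U (1 ℕ.* p) + (U (2 ℕ.* p) + 0ℤ))        ≡⟨ cong₂ (λ a b → a + (b + (U (2 ℕ.* p) + 0ℤ))) U0 Up ⟩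
      1ℤ + (0ℤ + (U (2 ℕ.* p) + 0ℤ))                  ≡⟨ cong (λ c → 1ℤ + (0ℤ + (c + 0ℤ))) U2p ⟩
      1ℤ + (0ℤ + (+ count p (2 ℕ.* p) xs + 0ℤ))       ≡⟨ simplify (+ count p (2 ℕ.* p) xs) ⟩
      + count p (2 ℕ.* p) xs + 1ℤ                     ∎
      where
      open ≡-Reasoning
      U : ℕ → ℤ
      U = signedCount xs
      simplify : ∀ c → 1ℤ + (0ℤ + (c + 0ℤ)) ≡ c + 1ℤ
      simplify = solve-∀
      U-off : ∀ {k} → ¬ p ℕ.∣ k → U k ≡ 0ℤ
      U-off {k} p∤k =
        trans (cong (λ i → -1ℤ ^ k * (i * + count p k xs)) (indicator-no (+ p ∣? + k) (p∤k ∘ ∣⇒∣ᵤ)))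
              (ℤ.*-zeroʳ (-1ℤ ^ k))
      U0 : U 0 ≡ 1ℤ
      U0 = cong₂ (λ i c → 1ℤ * (i * + c)) (indicator-yes (+ p ∣? 0ℤ) (divides 0ℤ refl)) (count0≡1 xs)
      Up : U (1 ℕ.* p) ≡ 0ℤ
      Up = trans (cong (λ c → -1ℤ ^ (1 ℕ.* p) * (indicator (+ p ∣? + (1 ℕ.* p)) * + c))
                       (trans (cong (λ k → count p k xs) (ℕ.+-identityʳ p)) none))
                 (trans (cong (-1ℤ ^ (1 ℕ.* p) *_) (ℤ.*-zeroʳ (indicator (+ p ∣? + (1 ℕ.* p)))))
                        (ℤ.*-zeroʳ (-1ℤ ^ (1 ℕ.* p))))
      even : -1ℤ ^ (2 ℕ.* p) ≡ 1ℤ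
      even = trans (sym (ℤ.^-*-assoc -1ℤ 2 p)) (ℤ.^-zeroˡ p)
      U2p : U (2 ℕ.* p) ≡ + count p (2 ℕ.* p) xs
      U2p = trans (cong₂ (λ s i → s * (i * + count p (2 ℕ.* p) xs)) even
                         (indicator-yes (+ p ∣? + (2 ℕ.* p)) (∣ᵤ⇒∣ (ℕ.n∣m*n 2))))
                  (trans (ℤ.*-identityˡ _) (ℤ.*-identityˡ _))

    p∣count[2p]+1 : ∀ xs → suc (pred p ℕ.+ (pred p ℕ.+ pred p)) ≤ length xs → length xs < 3 ℕ.* p →
                    count p p xs ≡ 0 → p ℕ.∣ count p (2 ℕ.* p) xs ℕ.+ 1
    p∣count[2p]+1 xs lower upper none = ∣⇒∣ᵤ (≈0⇒∣ (begin
      + count p (2 ℕ.* p) xs + 1ℤ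
        ≡⟨ ∑<-signedCount xs none ⟨
      ∑< (3 ℕ.* p) (signedCount xs)
        ≈⟨ ∑<-congᴹ (3 ℕ.* p) (λ k → *-cong (≈-refl { -1ℤ ^ k}) (sumMap-χ∘weight k xs)) ⟨
      ∑< (3 ℕ.* p) (λ k → -1ℤ ^ k * sumMap (χ ∘ weight) (choose k xs))
        ≡⟨ alternatingSum-choose xs (χ ∘ weight) (3 ℕ.* p) upper ⟨
      alternatingSum xs (χ ∘ weight)
        ≡⟨ alternatingSum-vanishes weight (λ x → (1ℤ , x)) (λ _ _ → refl) xs DegreeBelow-χ lower ⟩
      0ℤ ∎))
      where open import Relation.Binary.Reasoning.Setoid ≈-setoid

open import Data.Nat using (ℕ; _+_; _*_; _∸_)
open import Data.Nat.Primality using (Prime)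
open import Data.Nat.Divisibility using (_∣_)
open import Data.List using (List; length)
open import Data.List.Relation.Unary.Unique.Propositional using (Unique)
open import Data.Sum using (_⊎_)
open import Relation.Binary.PropositionalEquality using (_≡_; _≢_)
open import Data.Product using (proj₁; proj₂)

corollary3 : (p : ℕ) → Prime p → p ≢ 2 →
    (J : List Point) → Unique J →
    (length J ≡ 3 * p ∸ 2 ⊎ length J ≡ 3 * p ∸ 1) →
    count p p J ≡ 0 →
    p ∣ count p (2 * p) J + 1
corollary3 p isPrime _ J _ size none =
  p∣count[2p]+1 J (proj₁ (sizeBounds p size)) (proj₂ (sizeBounds p size)) none
  where
  open ModPrime isPrime
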